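{- Let $t\ge1$ and let $n_1,\dots,n_k$ be positive integers. Then \[ \mathcal{L}^{(t)}\Big(\prod_{i=1}^k T^{(t)}_{n_i}(x)\Big) \] equals the number of ways to mark exactly $\frac{1}{t+1}$ of the vertices of $\mathrm{cyc}(n_1)\sqcup\cdots\sqcup\mathrm{cyc}(n_k)$ (and $0$ if the total number of vertices is not divisible by $t+1$) such that no marked vertex is followed by $t$ unmarked vertices.
   Context: For $n\ge1$, $\mathrm{cyc}(n)$ is the cycle with vertices labeled $1,\dots,n$ in cyclic order (a $1$-cycle is a single vertex; a $2$-cycle has two vertices joined by two parallel edges). A $t$-path in $\mathrm{cyc}(n)$ exists only if $n\ge t+1$; it is specified by a starting vertex $i$ and consists of the $t$ consecutive edges through the vertices $i,i+1,\dots,i+t$ (indices mod $n$), so $\mathrm{cyc}(n)$ has exactly $n$ $t$-paths when $n\ge t+1$. The Chebyshev polynomial of the first kind and order $t$ is $T^{(t)}_n(x)=\sum_S(-1)^{|S|}x^{\,n-(t+1)|S|}$, summed over all sets $S$ of pairwise vertex-disjoint $t$-paths in $\mathrm{cyc}(n)$. Let $\mathcal{L}^{(t)}$ be the linear functional on polynomials with $\mathcal{L}^{(t)}(x^{(t+1)n})=\binom{(t+1)n}{n}$ for $n\ge0$ and $\mathcal{L}^{(t)}(x^m)=0$ if $m$ is not a multiple of $t+1$. A marked vertex $v$ of $\mathrm{cyc}(n)$ is "followed by $t$ unmarked vertices" if the vertices $v+1,\dots,v+t$ (indices mod $n$) are all unmarked; in particular this never happens when $n\le t$. -}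

module Defs where

open import Data.Bool using (Bool; true; false)
open import Data.Nat as ℕ using (ℕ; zero; suc; _∸_; _<_; _<?_; NonZero)
open import Data.Nat.DivMod using (_mod_; _/_)
open import Data.Nat.Divisibility using (_∣?_)
open import Data.Nat.Combinatorics using (_C_)
open import Data.Integer as ℤ using (ℤ; +_; -1ℤ; 0ℤ; 1ℤ)
open import Data.Fin using (Fin; toℕ)
open import Data.Fin.Properties using (all?) renaming (_≟_ to _≟ᶠ_)
open import Data.Fin.Subset using (Subset; _∈_; _∉_; ∣_∣)
open import Data.Fin.Subset.Properties using (_∈?_)
open import Data.List using (List; []; _∷_; [_]; _++_; map; replicate; foldr; zipWith; upTo; length; filter; concatMap)
open import Data.List.Relation.Unary.All using (All; []; _∷_)
open import Data.Vec using ([]; _∷_)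
open import Data.Product using (_×_)
open import Data.Product.Properties using () 
open import Data.Unit using (⊤; tt)
open import Relation.Nullary using (Dec; yes; no; ¬_; ¬?)
open import Relation.Nullary.Decidable using (_×-dec_; _→-dec_)
open import Relation.Binary.PropositionalEquality using (_≡_; _≢_)

-- Polynomials in x with integer coefficients, as coefficient lists
-- (constant term first; trailing zeros allowed).

Poly : Set
Poly = List ℤ

infixl 6 _+ₚ_
infixl 7 _*ₚ_

_+ₚ_ : Poly → Poly → Poly
[]      +ₚ q       = q
(a ∷ p) +ₚ []      = a ∷ p
(a ∷ p) +ₚ (b ∷ q) = (a ℤ.+ b) ∷ (p +ₚ q)

_*ₚ_ : Poly → Poly → Poly
[]      *ₚ q = []
(a ∷ p) *ₚ q = map (a ℤ.*_) q +ₚ (0ℤ ∷ (p *ₚ q))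

monomial : ℤ → ℕ → Poly
monomial c m = replicate m 0ℤ ++ [ c ]

sumPoly : List Poly → Poly
sumPoly = foldr _+ₚ_ []

prodPoly : List Poly → Poly
prodPoly = foldr _*ₚ_ [ 1ℤ ]

Lmon : ℕ → ℕ → ℤ
Lmon t m with suc t ∣? m
... | yes _ = + (m C (m / suc t))
... | no  _ = 0ℤ

L : ℕ → Poly → ℤ
L t p = foldr ℤ._+_ 0ℤ (zipWith (λ i c → c ℤ.* Lmon t i) (upTo (length p)) p)

-- The cycle cyc(n): vertices Fin n (labelled 0,…,n-1 in cyclic order).

shift : {n : ℕ} → Fin n → ℕ → Fin n
shift {suc m} i k = (toℕ i ℕ.+ k) mod (suc m)

-- t-paths of cyc(n): there are n of them if n ≥ t+1, none otherwise.
numPaths : ℕ → ℕ → ℕ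
numPaths t n with t <? n
... | yes _ = n
... | no  _ = 0

pathStart : (t n : ℕ) → Fin (numPaths t n) → Fin n
pathStart t n p with t <? n
... | yes _ = p

pathVertex : (t n : ℕ) → Fin (numPaths t n) → Fin (suc t) → Fin n
pathVertex t n p a = shift (pathStart t n p) (toℕ a)

Disjoint : (t n : ℕ) → Subset (numPaths t n) → Set
Disjoint t n S = ∀ p q → p ∈ S → q ∈ S → p ≢ q →
                 ∀ a b → pathVertex t n p a ≢ pathVertex t n q b

disjoint? : (t n : ℕ) (S : Subset (numPaths t n)) → Dec (Disjoint t n S)
disjoint? t n S =
  all? λ p → all? λ q → (p ∈? S) →-dec ((q ∈? S) →-dec (¬? (p ≟ᶠ q) →-dec
    all? λ a → all? λ b → ¬? (pathVertex t n p a ≟ᶠ pathVertex t n q b)))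

allSubsets : (n : ℕ) → List (Subset n)
allSubsets zero    = [ [] ]
allSubsets (suc n) = map (true ∷_) (allSubsets n) ++ map (false ∷_) (allSubsets n)

Tcheb : ℕ → ℕ → Poly
Tcheb t n = sumPoly (map (λ S → monomial (-1ℤ ℤ.^ ∣ S ∣) (n ∸ suc t ℕ.* ∣ S ∣))
                         (filter (disjoint? t n) (allSubsets (numPaths t n))))

-- Markings of cyc(n₁) ⊔ ⋯ ⊔ cyc(n_k): one subset of marked vertices per cycle.

Marking : List ℕ → Set
Marking ns = All Subset ns

allMarkings : (ns : List ℕ) → List (Marking ns)
allMarkings []       = [ [] ]
allMarkings (n ∷ ns) = concatMap (λ S → map (S ∷_) (allMarkings ns)) (allSubsets n)

totalVertices : List ℕ → ℕ
totalVertices = foldr ℕ._+_ 0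

numMarked : {ns : List ℕ} → Marking ns → ℕ
numMarked []      = 0
numMarked (S ∷ m) = ∣ S ∣ ℕ.+ numMarked m

FollowedByUnmarked : (t : ℕ) {n : ℕ} → Subset n → Fin n → Set
FollowedByUnmarked t {n} S v = t < n × (∀ (j : Fin t) → shift v (suc (toℕ j)) ∉ S)

GoodCycle : (t : ℕ) {n : ℕ} → Subset n → Set
GoodCycle t S = ∀ v → v ∈ S → ¬ FollowedByUnmarked t S v

GoodMarking : (t : ℕ) {ns : List ℕ} → Marking ns → Set
GoodMarking t []      = ⊤
GoodMarking t (S ∷ m) = GoodCycle t S × GoodMarking t m

Valid : (t : ℕ) (ns : List ℕ) → Marking ns → Set
Valid t ns m = suc t ℕ.* numMarked m ≡ totalVertices ns × GoodMarking t m

goodCycle? : (t : ℕ) {n : ℕ} (S : Subset n) → Dec (GoodCycle t S)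
goodCycle? t {n} S = all? λ v → (v ∈? S) →-dec ¬? ((t <? n) ×-dec all? λ j → ¬? (shift v (suc (toℕ j)) ∈? S))

goodMarking? : (t : ℕ) {ns : List ℕ} (m : Marking ns) → Dec (GoodMarking t m)
goodMarking? t []      = yes tt
goodMarking? t (S ∷ m) = goodCycle? t S ×-dec goodMarking? t m

valid? : (t : ℕ) (ns : List ℕ) (m : Marking ns) → Dec (Valid t ns m)
valid? t ns m = (suc t ℕ.* numMarked m ℕ.≟ totalVertices ns) ×-dec goodMarking? t m

-- number of valid markings (automatically 0 if t+1 ∤ total vertices)
countMarkings : ℕ → List ℕ → ℕ
countMarkings t ns = length (filter (valid? t ns) (allMarkings ns))

module Submission where

-- Expanding the product, L(∏ᵢ T_{nᵢ}) is a signed sum over families S of vertex-disjoint t-paths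
-- (one family per cycle) of L(x^m), where m = N − (t+1)|S| is the number of uncovered vertices.
-- Now L(x^m) = Σⱼ (m choose j)[(t+1)j = m] counts the sets M of uncovered vertices with
-- (t+1)(|S| + |M|) = N, so L(∏ᵢ T_{nᵢ}) = Σ (−1)^|S| over pairs (S, M).  Map such a pair to the
-- marking M ∪ {starts of S}.  For a fixed marking, the admissible S are exactly the subsets of
-- its set of violations (marked vertices followed by t unmarked ones), so by inclusion–exclusion
-- the signed count is 1 if there is no violation and 0 otherwise.  The computation runs cycle by
-- cycle, carrying as a weight ψ the number of vertices marked so far.

open import Defs
open import Data.Bool using (Bool; true; false; _∧_; _∨_)
open import Data.Empty using (⊥-elim)
open import Data.Fin using (Fin; zero; suc; toℕ; fromℕ<) renaming (_≟_ to _≟ᶠ_)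
open import Data.Fin.Properties using (toℕ-injective; toℕ<n; toℕ-fromℕ<; suc-injective; any?; all?)
open import Data.Fin.Subset using (Subset; _∈_; _∉_; _⊆_; _∪_; _─_; ∁; ⊥; ∣_∣)
open import Data.Fin.Subset.Properties
  using (_∈?_; _⊆?_; drop-∷-⊆; ∉⊥; ⊆-trans; p⊆q⇒∁p⊇∁q; x∉p⇒x∈∁p; x∈∁p⇒x∉p; x∈p∧x∉q⇒x∈p─q; p─q⊆p; ∣∁p∣≡n∸∣p∣; ∣p∣≤n)
open import Data.Integer as ℤ using (ℤ; +_; -1ℤ; 0ℤ; 1ℤ; _+_; _*_)
import Data.Integer.Properties as ℤ
open import Data.Integer.Tactic.RingSolver using (solve-∀)
open import Data.List using (List; []; _∷_; _++_; map; foldr; zipWith; applyUpTo; length; filter; concatMap; allFin)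
open import Data.List.Properties using (map-tabulate; length-tabulate)
open import Data.List.Relation.Unary.All using (All; _∷_)
open import Data.Nat as ℕ using (ℕ; zero; suc; _∸_; _≤_; _<_; _<?_; _≟_; _%_)
import Data.Nat.Properties as ℕ
open import Data.Nat.Combinatorics using (_C_; nCk+nC[k+1]≡[n+1]C[k+1])
open import Data.Nat.DivMod using (_/_; m*n/n≡m; [m+kn]%n≡m%n; %-distribˡ-+; m%n%n≡m%n; m<n⇒m%n≡m)
open import Data.Nat.Divisibility using (_∣?_; divides)
import Data.Nat.Tactic.RingSolver as ℕ-Solver
open import Data.Product using (∃; _×_; _,_; proj₁; proj₂)
open import Data.Sum using (inj₁; inj₂)
open import Data.Vec using ([]; _∷_; tabulate; here; there)
open import Data.Vec.Properties using (lookup∘tabulate; []=⇒lookup; lookup⇒[]=)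
open import Function using (id; _∘_; _⇔_; mk⇔)
open import Relation.Nullary using (Dec; yes; no; does; ¬_; ¬?)
open import Relation.Nullary.Decidable using (_×-dec_; _→-dec_; dec-true; dec-false; does-⇔)
open import Relation.Nullary.Negation using (contradiction)
open import Relation.Unary using (Pred; Decidable)
open import Relation.Binary.PropositionalEquality using (_≡_; _≢_; refl; sym; trans; cong; cong₂; subst; module ≡-Reasoning)
open ≡-Reasoning

when : Bool → ℤ → ℤ
when true  x = x
when false _ = 0ℤ

when-*ˡ : ∀ b a x → when b (a * x) ≡ a * when b x
when-*ˡ true  a x = refl
when-*ˡ false a x = sym (ℤ.*-zeroʳ a)

when-comm : ∀ b c x → when b (when c x) ≡ when c (when b x)
when-comm true  c     x = refl
when-comm false true  x = refl
when-comm false false x = refl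

when-∧ : ∀ b c x → when (b ∧ c) x ≡ when b (when c x)
when-∧ true  c x = refl
when-∧ false c x = refl

when-zero : ∀ b → when b 0ℤ ≡ 0ℤ
when-zero true  = refl
when-zero false = refl

when-*ʳ : ∀ b x y → when b (x * y) ≡ when b x * y
when-*ʳ true  x y = refl
when-*ʳ false x y = sym (ℤ.*-zeroˡ y)

when-1* : ∀ b x → when b 1ℤ * x ≡ when b x
when-1* true  x = ℤ.*-identityˡ x
when-1* false x = ℤ.*-zeroˡ x

when-cong-dec : ∀ {p} {P : Set p} (P? : Dec P) {x y} → (P → x ≡ y) → when (does P?) x ≡ when (does P?) y
when-cong-dec (yes p) x≡y = x≡y p
when-cong-dec (no _)  x≡y = refl

∑ : {A : Set} → List A → (A → ℤ) → ℤ
∑ []       f = 0ℤ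
∑ (x ∷ xs) f = f x + ∑ xs f

syntax ∑ xs (λ x → e) = ∑[ x ∈ xs ] e

module _ {A : Set} where

  ∑-cong : ∀ (xs : List A) {f g : A → ℤ} → (∀ x → f x ≡ g x) → ∑ xs f ≡ ∑ xs g
  ∑-cong []       f≗g = refl
  ∑-cong (x ∷ xs) f≗g = cong₂ _+_ (f≗g x) (∑-cong xs f≗g)

  ∑-zero : ∀ (xs : List A) → ∑[ _ ∈ xs ] 0ℤ ≡ 0ℤ
  ∑-zero []       = refl
  ∑-zero (x ∷ xs) = trans (ℤ.+-identityˡ _) (∑-zero xs)

  ∑-distrib-+ : ∀ (xs : List A) (f g : A → ℤ) → ∑[ x ∈ xs ] (f x + g x) ≡ ∑ xs f + ∑ xs g
  ∑-distrib-+ []       f g = refl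
  ∑-distrib-+ (x ∷ xs) f g rewrite ∑-distrib-+ xs f g = lemma (f x) (g x) (∑ xs f) (∑ xs g)
    where lemma : ∀ a b c d → (a + b) + (c + d) ≡ (a + c) + (b + d)
          lemma = solve-∀

  *-distribˡ-∑ : ∀ (xs : List A) a (f : A → ℤ) → a * ∑ xs f ≡ ∑[ x ∈ xs ] (a * f x)
  *-distribˡ-∑ []       a f = ℤ.*-zeroʳ a
  *-distribˡ-∑ (x ∷ xs) a f =
    trans (ℤ.*-distribˡ-+ a (f x) (∑ xs f)) (cong (_+_ (a * f x)) (*-distribˡ-∑ xs a f))

  *-distribʳ-∑ : ∀ (xs : List A) a (f : A → ℤ) → ∑ xs f * a ≡ ∑[ x ∈ xs ] (f x * a)
  *-distribʳ-∑ xs a f = trans (ℤ.*-comm (∑ xs f) a)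
    (trans (*-distribˡ-∑ xs a f) (∑-cong xs (λ x → ℤ.*-comm a (f x))))

  when-∑ : ∀ (xs : List A) b (f : A → ℤ) → when b (∑ xs f) ≡ ∑[ x ∈ xs ] when b (f x)
  when-∑ xs true  f = refl
  when-∑ xs false f = sym (∑-zero xs)

  ∑-++ : ∀ (xs ys : List A) (f : A → ℤ) → ∑ (xs ++ ys) f ≡ ∑ xs f + ∑ ys f
  ∑-++ []       ys f = sym (ℤ.+-identityˡ _)
  ∑-++ (x ∷ xs) ys f = trans (cong (_+_ (f x)) (∑-++ xs ys f)) (sym (ℤ.+-assoc (f x) _ _))

  ∑-filter : ∀ {p} {P : Pred A p} (P? : Decidable P) (xs : List A) (f : A → ℤ) →
             ∑ (filter P? xs) f ≡ ∑[ x ∈ xs ] when (does (P? x)) (f x)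
  ∑-filter P? []       f = refl
  ∑-filter P? (x ∷ xs) f with does (P? x)
  ... | true  = cong (_+_ (f x)) (∑-filter P? xs f)
  ... | false = trans (∑-filter P? xs f) (sym (ℤ.+-identityˡ _))

  ∑-const-1 : ∀ (xs : List A) → ∑[ _ ∈ xs ] 1ℤ ≡ + length xs
  ∑-const-1 []       = refl
  ∑-const-1 (x ∷ xs) = trans (cong (_+_ 1ℤ) (∑-const-1 xs)) (sym (ℤ.pos-+ 1 (length xs)))

module _ {A B : Set} where

  ∑-map : ∀ (g : A → B) (xs : List A) (f : B → ℤ) → ∑ (map g xs) f ≡ ∑ xs (f ∘ g)
  ∑-map g []       f = refl
  ∑-map g (x ∷ xs) f = cong (_+_ (f (g x))) (∑-map g xs f)

  ∑-concatMap : ∀ (g : A → List B) (xs : List A) (f : B → ℤ) →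
                ∑ (concatMap g xs) f ≡ ∑[ x ∈ xs ] ∑ (g x) f
  ∑-concatMap g []       f = refl
  ∑-concatMap g (x ∷ xs) f =
    trans (∑-++ (g x) (concatMap g xs) f) (cong (_+_ (∑ (g x) f)) (∑-concatMap g xs f))

  ∑-comm : ∀ (xs : List A) (ys : List B) (f : A → B → ℤ) →
           ∑[ x ∈ xs ] ∑[ y ∈ ys ] f x y ≡ ∑[ y ∈ ys ] ∑[ x ∈ xs ] f x y
  ∑-comm []       ys f = sym (∑-zero ys)
  ∑-comm (x ∷ xs) ys f =
    trans (cong (_+_ (∑ ys (f x))) (∑-comm xs ys f)) (sym (∑-distrib-+ ys (f x) _))

-- Λ φ is the linear functional on ℤ[x] with Λ φ (x^i) = φ i.
Λ : (ℕ → ℤ) → Poly → ℤ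
Λ φ []      = 0ℤ
Λ φ (c ∷ p) = c * φ 0 + Λ (φ ∘ suc) p

L≡Λ : ∀ t p → L t p ≡ Λ (Lmon t) p
L≡Λ t = go id
  where
  go : ∀ (g : ℕ → ℕ) p →
       foldr _+_ 0ℤ (zipWith (λ i c → c * Lmon t i) (applyUpTo g (length p)) p) ≡ Λ (Lmon t ∘ g) p
  go g []      = refl
  go g (c ∷ p) = cong (_+_ (c * Lmon t (g 0))) (go (g ∘ suc) p)

Λ-+ₚ : ∀ φ p q → Λ φ (p +ₚ q) ≡ Λ φ p + Λ φ q
Λ-+ₚ φ []      q       = sym (ℤ.+-identityˡ _)
Λ-+ₚ φ (a ∷ p) []      = sym (ℤ.+-identityʳ _)
Λ-+ₚ φ (a ∷ p) (b ∷ q) rewrite Λ-+ₚ (φ ∘ suc) p q = lemma a b (φ 0) (Λ (φ ∘ suc) p) (Λ (φ ∘ suc) q)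
  where lemma : ∀ a b x u v → (a + b) * x + (u + v) ≡ (a * x + u) + (b * x + v)
        lemma = solve-∀

Λ-scale : ∀ φ a q → Λ φ (map (a *_) q) ≡ a * Λ φ q
Λ-scale φ a []      = sym (ℤ.*-zeroʳ a)
Λ-scale φ a (c ∷ q) rewrite Λ-scale (φ ∘ suc) a q = lemma a c (φ 0) (Λ (φ ∘ suc) q)
  where lemma : ∀ a c x u → a * c * x + a * u ≡ a * (c * x + u)
        lemma = solve-∀

Λ-0∷ : ∀ φ p → Λ φ (0ℤ ∷ p) ≡ Λ (φ ∘ suc) p
Λ-0∷ φ p = trans (cong (_+ Λ (φ ∘ suc) p) (ℤ.*-zeroˡ (φ 0))) (ℤ.+-identityˡ _)

Λ-*ₚ : ∀ φ p q → Λ φ (p *ₚ q) ≡ Λ (λ i → Λ (λ j → φ (i ℕ.+ j)) q) p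
Λ-*ₚ φ []      q = refl
Λ-*ₚ φ (a ∷ p) q = begin
  Λ φ (map (a *_) q +ₚ (0ℤ ∷ p *ₚ q))        ≡⟨ Λ-+ₚ φ (map (a *_) q) _ ⟩
  Λ φ (map (a *_) q) + Λ φ (0ℤ ∷ p *ₚ q)     ≡⟨ cong₂ _+_ (Λ-scale φ a q) (Λ-0∷ φ (p *ₚ q)) ⟩
  a * Λ φ q + Λ (φ ∘ suc) (p *ₚ q)            ≡⟨ cong (_+_ (a * Λ φ q)) (Λ-*ₚ (φ ∘ suc) p q) ⟩
  a * Λ φ q + Λ (λ i → Λ (λ j → φ (suc i ℕ.+ j)) q) p  ∎

Λ-monomial : ∀ φ c m → Λ φ (monomial c m) ≡ c * φ m
Λ-monomial φ c zero    = ℤ.+-identityʳ _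
Λ-monomial φ c (suc m) = trans (Λ-0∷ φ (monomial c m)) (Λ-monomial (φ ∘ suc) c m)

Λ-sumPoly : ∀ φ ps → Λ φ (sumPoly ps) ≡ ∑[ p ∈ ps ] Λ φ p
Λ-sumPoly φ []       = refl
Λ-sumPoly φ (p ∷ ps) = trans (Λ-+ₚ φ p (sumPoly ps)) (cong (_+_ (Λ φ p)) (Λ-sumPoly φ ps))

Λ-Tcheb : ∀ φ t n → Λ φ (Tcheb t n) ≡
  ∑[ S ∈ allSubsets (numPaths t n) ]
    when (does (disjoint? t n S)) ((-1ℤ ℤ.^ ∣ S ∣) * φ (n ∸ suc t ℕ.* ∣ S ∣))
Λ-Tcheb φ t n = begin
  Λ φ (sumPoly (map term paths))   ≡⟨ Λ-sumPoly φ (map term paths) ⟩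
  ∑ (map term paths) (Λ φ)         ≡⟨ ∑-map term paths (Λ φ) ⟩
  ∑[ S ∈ paths ] Λ φ (term S)      ≡⟨ ∑-cong paths (λ S → Λ-monomial φ (-1ℤ ℤ.^ ∣ S ∣) _) ⟩
  ∑[ S ∈ paths ] ((-1ℤ ℤ.^ ∣ S ∣) * φ (n ∸ suc t ℕ.* ∣ S ∣))
    ≡⟨ ∑-filter (disjoint? t n) (allSubsets (numPaths t n)) _ ⟩
  ∑[ S ∈ allSubsets (numPaths t n) ]
    when (does (disjoint? t n S)) ((-1ℤ ℤ.^ ∣ S ∣) * φ (n ∸ suc t ℕ.* ∣ S ∣)) ∎
  where
  paths = filter (disjoint? t n) (allSubsets (numPaths t n))
  term : Subset (numPaths t n) → Poly
  term S = monomial (-1ℤ ℤ.^ ∣ S ∣) (n ∸ suc t ℕ.* ∣ S ∣)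

-- binomialSum k χ = Σⱼ (k choose j) χ j
binomialSum : ℕ → (ℕ → ℤ) → ℤ
binomialSum zero    χ = χ 0
binomialSum (suc k) χ = binomialSum k (χ ∘ suc) + binomialSum k χ

binomialSum-cong : ∀ k {χ χ′ : ℕ → ℤ} → (∀ i → χ i ≡ χ′ i) → binomialSum k χ ≡ binomialSum k χ′
binomialSum-cong zero    χ≗χ′ = χ≗χ′ 0
binomialSum-cong (suc k) χ≗χ′ =
  cong₂ _+_ (binomialSum-cong k (χ≗χ′ ∘ suc)) (binomialSum-cong k χ≗χ′)

binomialSum-+ : ∀ a b χ → binomialSum (a ℕ.+ b) χ ≡ binomialSum a (λ i → binomialSum b (λ j → χ (i ℕ.+ j)))
binomialSum-+ zero    b χ = refl
binomialSum-+ (suc a) b χ = cong₂ _+_ (binomialSum-+ a b (χ ∘ suc)) (binomialSum-+ a b χ)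

binomialSum-zero : ∀ k → binomialSum k (λ _ → 0ℤ) ≡ 0ℤ
binomialSum-zero zero    = refl
binomialSum-zero (suc k) rewrite binomialSum-zero k = refl

binomialSum-δ : ∀ m q → binomialSum m (λ j → when (does (j ≟ q)) 1ℤ) ≡ + (m C q)
binomialSum-δ zero    zero    = refl
binomialSum-δ zero    (suc q) = refl
binomialSum-δ (suc m) zero    = begin
  binomialSum m (λ j → when (does (suc j ≟ 0)) 1ℤ) + binomialSum m (λ j → when (does (j ≟ 0)) 1ℤ)
    ≡⟨ cong₂ _+_ (binomialSum-zero m) (binomialSum-δ m zero) ⟩
  0ℤ + + (m C 0)  ≡⟨ ℤ.+-identityˡ _ ⟩
  + 1             ∎
binomialSum-δ (suc m) (suc q) = begin
  binomialSum m (λ j → when (does (suc j ≟ suc q)) 1ℤ) + binomialSum m (λ j → when (does (j ≟ suc q)) 1ℤ)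
    ≡⟨ cong (_+ binomialSum m (λ j → when (does (j ≟ suc q)) 1ℤ)) (binomialSum-cong m λ j →
         cong (λ b → when b 1ℤ) (does-⇔ (mk⇔ ℕ.suc-injective (cong suc)) (suc j ≟ suc q) (j ≟ q))) ⟩
  binomialSum m (λ j → when (does (j ≟ q)) 1ℤ) + binomialSum m (λ j → when (does (j ≟ suc q)) 1ℤ)
    ≡⟨ cong₂ _+_ (binomialSum-δ m q) (binomialSum-δ m (suc q)) ⟩
  + (m C q) + + (m C suc q)  ≡⟨ sym (ℤ.pos-+ (m C q) (m C suc q)) ⟩
  + (m C q ℕ.+ m C suc q)    ≡⟨ cong +_ (nCk+nC[k+1]≡[n+1]C[k+1] m q) ⟩
  + (suc m C suc q)          ∎

Lmon≡binomialSum : ∀ t m → Lmon t m ≡ binomialSum m (λ j → when (does (suc t ℕ.* j ≟ m)) 1ℤ)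
Lmon≡binomialSum t m with suc t ∣? m
... | yes (divides q m≡q[t+1]) = begin
  + (m C (m / suc t))                               ≡⟨ cong (λ k → + (m C k)) m/[t+1]≡q ⟩
  + (m C q)                                         ≡⟨ binomialSum-δ m q ⟨
  binomialSum m (λ j → when (does (j ≟ q)) 1ℤ)     ≡⟨ binomialSum-cong m (λ j →
                                                         cong (λ b → when b 1ℤ) (does-⇔ (mk⇔ to from) (j ≟ q) (suc t ℕ.* j ≟ m))) ⟩
  binomialSum m (λ j → when (does (suc t ℕ.* j ≟ m)) 1ℤ) ∎
  where
  m/[t+1]≡q : m / suc t ≡ q
  m/[t+1]≡q = trans (cong (_/ suc t) m≡q[t+1]) (m*n/n≡m q (suc t))
  to : ∀ {j} → j ≡ q → suc t ℕ.* j ≡ m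
  to refl = trans (ℕ.*-comm (suc t) q) (sym m≡q[t+1])
  from : ∀ {j} → suc t ℕ.* j ≡ m → j ≡ q
  from {j} e = ℕ.*-cancelʳ-≡ j q (suc t) (trans (ℕ.*-comm j (suc t)) (trans e m≡q[t+1]))
... | no ∤m = sym (trans (binomialSum-cong m λ j → cong (λ b → when b 1ℤ) (dec-false (_ ≟ m) (λ e →
                  ∤m (divides j (trans (sym e) (ℕ.*-comm (suc t) j))))))
                  (binomialSum-zero m))

∑-allSubsets-suc : ∀ n (f : Subset (suc n) → ℤ) →
  ∑ (allSubsets (suc n)) f ≡ ∑[ M ∈ allSubsets n ] f (true ∷ M) + ∑[ M ∈ allSubsets n ] f (false ∷ M)
∑-allSubsets-suc n f = trans (∑-++ (map (true ∷_) (allSubsets n)) (map (false ∷_) (allSubsets n)) f)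
  (cong₂ _+_ (∑-map (true ∷_) (allSubsets n) f) (∑-map (false ∷_) (allSubsets n) f))

∑-allSubsets-size : ∀ n χ → ∑[ M ∈ allSubsets n ] χ ∣ M ∣ ≡ binomialSum n χ
∑-allSubsets-size zero    χ = ℤ.+-identityʳ (χ 0)
∑-allSubsets-size (suc n) χ = trans (∑-allSubsets-suc n (χ ∘ ∣_∣))
  (cong₂ _+_ (∑-allSubsets-size n (χ ∘ suc)) (∑-allSubsets-size n χ))

∑-⊆-size : ∀ {n} (D : Subset n) χ →
  ∑[ M ∈ allSubsets n ] when (does (M ⊆? D)) (χ ∣ M ∣) ≡ binomialSum ∣ D ∣ χ
∑-⊆-size []          χ = ℤ.+-identityʳ (χ 0)
∑-⊆-size {suc n} (true  ∷ D) χ = trans (∑-allSubsets-suc n (λ M → when (does (M ⊆? true ∷ D)) (χ ∣ M ∣)))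
  (cong₂ _+_ (∑-⊆-size D (χ ∘ suc)) (∑-⊆-size D χ))
∑-⊆-size {suc n} (false ∷ D) χ = trans (∑-allSubsets-suc n (λ M → when (does (M ⊆? false ∷ D)) (χ ∣ M ∣)))
  (trans (cong₂ _+_ (∑-zero (allSubsets n)) (∑-⊆-size D χ)) (ℤ.+-identityˡ _))

∑-reindex-∪ : ∀ {n} (S : Subset n) (F : Subset n → ℤ) →
  ∑[ M ∈ allSubsets n ] when (does (M ⊆? ∁ S)) (F (M ∪ S)) ≡ ∑[ M ∈ allSubsets n ] when (does (S ⊆? M)) (F M)
∑-reindex-∪ []          F = refl
∑-reindex-∪ {suc n} (true  ∷ S) F = begin
  ∑[ M ∈ allSubsets (suc n) ] when (does (M ⊆? ∁ (true ∷ S))) (F (M ∪ (true ∷ S)))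
                   ≡⟨ ∑-allSubsets-suc n (λ M → when (does (M ⊆? ∁ (true ∷ S))) (F (M ∪ (true ∷ S)))) ⟩
  0ℤ′ + ∑[ M ∈ allSubsets n ] when (does (M ⊆? ∁ S)) (F (true ∷ (M ∪ S)))
                   ≡⟨ cong₂ _+_ (∑-zero (allSubsets n)) (∑-reindex-∪ S (F ∘ (true ∷_))) ⟩
  0ℤ + X           ≡⟨ trans (ℤ.+-identityˡ X) (sym (ℤ.+-identityʳ X)) ⟩
  X + 0ℤ           ≡⟨ cong (_+_ X) (∑-zero (allSubsets n)) ⟨
  X + 0ℤ′          ≡⟨ ∑-allSubsets-suc n (λ M → when (does (true ∷ S ⊆? M)) (F M)) ⟨
  ∑[ M ∈ allSubsets (suc n) ] when (does (true ∷ S ⊆? M)) (F M) ∎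
  where
  X = ∑[ M ∈ allSubsets n ] when (does (S ⊆? M)) (F (true ∷ M))
  0ℤ′ = ∑[ M ∈ allSubsets n ] 0ℤ
∑-reindex-∪ {suc n} (false ∷ S) F =
  trans (∑-allSubsets-suc n (λ M → when (does (M ⊆? ∁ (false ∷ S))) (F (M ∪ (false ∷ S)))))
  (trans (cong₂ _+_ (∑-reindex-∪ S (F ∘ (true ∷_))) (∑-reindex-∪ S (F ∘ (false ∷_))))
         (sym (∑-allSubsets-suc n (λ M → when (does (false ∷ S ⊆? M)) (F M)))))

∑-⊆-alternating : ∀ {n} (D : Subset n) →
  ∑[ S ∈ allSubsets n ] when (does (S ⊆? D)) (-1ℤ ℤ.^ ∣ S ∣) ≡ when (does (D ⊆? ⊥)) 1ℤ
∑-⊆-alternating []          = refl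
∑-⊆-alternating {suc n} (true  ∷ D) = begin
  ∑[ S ∈ allSubsets (suc n) ] when (does (S ⊆? true ∷ D)) (-1ℤ ℤ.^ ∣ S ∣)
                              ≡⟨ ∑-allSubsets-suc n (λ S → when (does (S ⊆? true ∷ D)) (-1ℤ ℤ.^ ∣ S ∣)) ⟩
  ∑[ S ∈ allSubsets n ] when (does (S ⊆? D)) (-1ℤ * (-1ℤ ℤ.^ ∣ S ∣)) + X
                              ≡⟨ cong (_+ X) (trans (∑-cong (allSubsets n) (λ S → when-*ˡ (does (S ⊆? D)) -1ℤ (-1ℤ ℤ.^ ∣ S ∣)))
                                                    (sym (*-distribˡ-∑ (allSubsets n) -1ℤ (λ S → when (does (S ⊆? D)) (-1ℤ ℤ.^ ∣ S ∣))))) ⟩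
  -1ℤ * X + X                 ≡⟨ cancel X ⟩
  0ℤ                          ∎
  where
  X = ∑[ S ∈ allSubsets n ] when (does (S ⊆? D)) (-1ℤ ℤ.^ ∣ S ∣)
  cancel : ∀ x → -1ℤ * x + x ≡ 0ℤ
  cancel = solve-∀
∑-⊆-alternating {suc n} (false ∷ D) = trans (∑-allSubsets-suc n (λ S → when (does (S ⊆? false ∷ D)) (-1ℤ ℤ.^ ∣ S ∣)))
  (trans (cong₂ _+_ (∑-zero (allSubsets n)) (∑-⊆-alternating D)) (ℤ.+-identityˡ _))

∣p∪q∣≡∣q∣+∣p∣ : ∀ {n} (M S : Subset n) → M ⊆ ∁ S → ∣ M ∪ S ∣ ≡ ∣ S ∣ ℕ.+ ∣ M ∣
∣p∪q∣≡∣q∣+∣p∣ []          []          _    = refl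
∣p∪q∣≡∣q∣+∣p∣ (true  ∷ M) (true  ∷ S) M⊆∁S = contradiction (M⊆∁S here) λ ()
∣p∪q∣≡∣q∣+∣p∣ (true  ∷ M) (false ∷ S) M⊆∁S =
  trans (cong suc (∣p∪q∣≡∣q∣+∣p∣ M S (drop-∷-⊆ M⊆∁S))) (sym (ℕ.+-suc ∣ S ∣ ∣ M ∣))
∣p∪q∣≡∣q∣+∣p∣ (false ∷ M) (true  ∷ S) M⊆∁S = cong suc (∣p∪q∣≡∣q∣+∣p∣ M S (drop-∷-⊆ M⊆∁S))
∣p∪q∣≡∣q∣+∣p∣ (false ∷ M) (false ∷ S) M⊆∁S = ∣p∪q∣≡∣q∣+∣p∣ M S (drop-∷-⊆ M⊆∁S)

[p∪q]─q≡p : ∀ {n} (M S : Subset n) → M ⊆ ∁ S → (M ∪ S) ─ S ≡ M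
[p∪q]─q≡p []          []          _    = refl
[p∪q]─q≡p (true  ∷ M) (true  ∷ S) M⊆∁S = contradiction (M⊆∁S here) λ ()
[p∪q]─q≡p (true  ∷ M) (false ∷ S) M⊆∁S = cong (true ∷_) ([p∪q]─q≡p M S (drop-∷-⊆ M⊆∁S))
[p∪q]─q≡p (false ∷ M) (true  ∷ S) M⊆∁S = cong (false ∷_) ([p∪q]─q≡p M S (drop-∷-⊆ M⊆∁S))
[p∪q]─q≡p (false ∷ M) (false ∷ S) M⊆∁S = cong (false ∷_) ([p∪q]─q≡p M S (drop-∷-⊆ M⊆∁S))

∑-allFin-suc : ∀ k (f : Fin (suc k) → ℤ) → ∑ (allFin (suc k)) f ≡ f zero + ∑[ i ∈ allFin k ] f (suc i)
∑-allFin-suc k f =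
  cong (_+_ (f zero)) (trans (cong (λ is → ∑ is f) (sym (map-tabulate id suc))) (∑-map suc (allFin k) f))

∣p∣≡∑ : ∀ {k} (p : Subset k) → + ∣ p ∣ ≡ ∑[ v ∈ allFin k ] when (does (v ∈? p)) 1ℤ
∣p∣≡∑ []          = refl
∣p∣≡∑ (true  ∷ p) = trans (ℤ.pos-+ 1 ∣ p ∣) (trans (cong (_+_ 1ℤ) (∣p∣≡∑ p))
  (sym (∑-allFin-suc _ (λ v → when (does (v ∈? true ∷ p)) 1ℤ))))
∣p∣≡∑ (false ∷ p) = trans (∣p∣≡∑ p) (trans (sym (ℤ.+-identityˡ _))
  (sym (∑-allFin-suc _ (λ v → when (does (v ∈? false ∷ p)) 1ℤ))))

∑-allFin-1 : ∀ k → ∑[ _ ∈ allFin k ] 1ℤ ≡ + k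
∑-allFin-1 k = trans (∑-const-1 (allFin k)) (cong +_ (length-tabulate id))

∑-atMostOne : ∀ {k ℓ} {P : Pred (Fin k) ℓ} (P? : Decidable P) → (∀ {i j} → P i → P j → i ≡ j) →
              ∑[ i ∈ allFin k ] when (does (P? i)) 1ℤ ≡ when (does (any? P?)) 1ℤ
∑-atMostOne {zero}  P? unique = refl
∑-atMostOne {suc k} {P = P} P? unique = trans (∑-allFin-suc k (λ i → when (does (P? i)) 1ℤ)) (first (P? zero))
  where
  rest : ∑[ i ∈ allFin k ] when (does (P? (suc i))) 1ℤ ≡ when (does (any? (P? ∘ suc))) 1ℤ
  rest = ∑-atMostOne (P? ∘ suc) (λ Pi Pj → suc-injective (unique Pi Pj))
  first : (P0? : Dec (P zero)) → when (does P0?) 1ℤ + ∑[ i ∈ allFin k ] when (does (P? (suc i))) 1ℤ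
                                 ≡ when (does P0? ∨ does (any? (P? ∘ suc))) 1ℤ
  first (yes P0) = cong (_+_ 1ℤ) (trans (∑-cong (allFin k) λ i →
                     cong (λ b → when b 1ℤ) (dec-false (P? (suc i)) λ Pi → zero≢suc (unique P0 Pi)))
                     (∑-zero (allFin k)))
    where zero≢suc : ∀ {i : Fin k} → zero ≢ suc i
          zero≢suc ()
  first (no _)   = trans (ℤ.+-identityˡ _) rest

∑-δ : ∀ {k} (c : Fin k) → ∑[ v ∈ allFin k ] when (does (v ≟ᶠ c)) 1ℤ ≡ 1ℤ
∑-δ c = trans (∑-atMostOne (_≟ᶠ c) (λ i≡c j≡c → trans i≡c (sym j≡c)))
              (cong (λ b → when b 1ℤ) (dec-true (any? (_≟ᶠ c)) (c , refl)))

module _ {m : ℕ} where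

  private
    n = suc m

  toℕ-shift : ∀ (v : Fin n) k → toℕ (shift v k) ≡ (toℕ v ℕ.+ k) % n
  toℕ-shift v k = toℕ-fromℕ< _

  %-cancelʳ-+ : ∀ u y b → (u ℕ.+ b) % n ≡ (y ℕ.+ b) % n → u % n ≡ y % n
  %-cancelʳ-+ u y b eq = begin
    u % n                          ≡⟨ [m+kn]%n≡m%n u b n ⟨
    (u ℕ.+ b ℕ.* n) % n            ≡⟨ cong (_% n) (regroup u) ⟩
    ((u ℕ.+ b) ℕ.+ b ℕ.* m) % n     ≡⟨ %-absorb (u ℕ.+ b) ⟩
    ((u ℕ.+ b) % n ℕ.+ b ℕ.* m) % n ≡⟨ cong (λ z → (z ℕ.+ b ℕ.* m) % n) eq ⟩
    ((y ℕ.+ b) % n ℕ.+ b ℕ.* m) % n ≡⟨ %-absorb (y ℕ.+ b) ⟨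
    ((y ℕ.+ b) ℕ.+ b ℕ.* m) % n     ≡⟨ cong (_% n) (regroup y) ⟨
    (y ℕ.+ b ℕ.* n) % n            ≡⟨ [m+kn]%n≡m%n y b n ⟩
    y % n                          ∎
    where
    regroup : ∀ u → u ℕ.+ b ℕ.* n ≡ (u ℕ.+ b) ℕ.+ b ℕ.* m
    regroup u = trans (cong (u ℕ.+_) (ℕ.*-suc b m)) (sym (ℕ.+-assoc u b (b ℕ.* m)))
    %-absorb : ∀ x → (x ℕ.+ b ℕ.* m) % n ≡ (x % n ℕ.+ b ℕ.* m) % n
    %-absorb x = trans (%-distribˡ-+ x (b ℕ.* m) n)
      (trans (cong (λ a → (a ℕ.+ (b ℕ.* m) % n) % n) (sym (m%n%n≡m%n x n)))
             (sym (%-distribˡ-+ (x % n) (b ℕ.* m) n)))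

  toℕ%n : ∀ (v : Fin n) → toℕ v % n ≡ toℕ v
  toℕ%n v = m<n⇒m%n≡m (toℕ<n v)

  shift-zero : ∀ (v : Fin n) → shift v 0 ≡ v
  shift-zero v = toℕ-injective (trans (toℕ-shift v 0) (trans (cong (_% n) (ℕ.+-identityʳ (toℕ v))) (toℕ%n v)))

  shift-∸ : ∀ (p q : Fin n) {a b} → b ≤ a → shift p a ≡ shift q b → shift p (a ∸ b) ≡ q
  shift-∸ p q {a} {b} b≤a eq = toℕ-injective (begin
    toℕ (shift p (a ∸ b))      ≡⟨ toℕ-shift p (a ∸ b) ⟩
    (toℕ p ℕ.+ (a ∸ b)) % n    ≡⟨ %-cancelʳ-+ (toℕ p ℕ.+ (a ∸ b)) (toℕ q) b eq′ ⟩
    toℕ q % n                  ≡⟨ toℕ%n q ⟩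
    toℕ q                      ∎)
    where
    eq′ : (toℕ p ℕ.+ (a ∸ b) ℕ.+ b) % n ≡ (toℕ q ℕ.+ b) % n
    eq′ = begin
      (toℕ p ℕ.+ (a ∸ b) ℕ.+ b) % n ≡⟨ cong (_% n) (trans (ℕ.+-assoc (toℕ p) (a ∸ b) b)
                                                           (cong (toℕ p ℕ.+_) (ℕ.m∸n+n≡m b≤a))) ⟩
      (toℕ p ℕ.+ a) % n             ≡⟨ toℕ-shift p a ⟨
      toℕ (shift p a)               ≡⟨ cong toℕ eq ⟩
      toℕ (shift q b)               ≡⟨ toℕ-shift q b ⟩
      (toℕ q ℕ.+ b) % n             ∎

  shift≡⇒0 : ∀ (p : Fin n) {d} → d < n → shift p d ≡ p → d ≡ 0
  shift≡⇒0 p {d} d<n eq = trans (sym (m<n⇒m%n≡m d<n)) (%-cancelʳ-+ d 0 (toℕ p) eq′)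
    where
    eq′ : (d ℕ.+ toℕ p) % n ≡ toℕ p % n
    eq′ = trans (cong (_% n) (ℕ.+-comm d (toℕ p)))
                (trans (sym (toℕ-shift p d)) (trans (cong toℕ eq) (sym (toℕ%n p))))

  shift-injective : ∀ (p : Fin n) {a b} → a < n → b < n → shift p a ≡ shift p b → a ≡ b
  shift-injective p {a} {b} a<n b<n eq with ℕ.≤-total b a
  ... | inj₁ b≤a =
    ℕ.≤-antisym (ℕ.m∸n≡0⇒m≤n (shift≡⇒0 p (ℕ.≤-<-trans (ℕ.m∸n≤m a b) a<n) (shift-∸ p p b≤a eq))) b≤a
  ... | inj₂ a≤b =
    ℕ.≤-antisym a≤b (ℕ.m∸n≡0⇒m≤n (shift≡⇒0 p (ℕ.≤-<-trans (ℕ.m∸n≤m b a) b<n) (shift-∸ p p a≤b (sym eq))))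

fromDec : ∀ {n ℓ} {P : Pred (Fin n) ℓ} → Decidable P → Subset n
fromDec P? = tabulate (does ∘ P?)

module _ {n ℓ} {P : Pred (Fin n) ℓ} (P? : Decidable P) where

  ∈fromDec⁺ : ∀ {x} → P x → x ∈ fromDec P?
  ∈fromDec⁺ {x} Px = lookup⇒[]= x (fromDec P?) (trans (lookup∘tabulate (does ∘ P?) x) (dec-true (P? x) Px))

  ∈fromDec⁻ : ∀ {x} → x ∈ fromDec P? → P x
  ∈fromDec⁻ {x} x∈ with P? x | trans (sym (lookup∘tabulate (does ∘ P?) x)) ([]=⇒lookup x∈)
  ... | yes Px | _ = Px
  ... | no  _  | ()

  ∈fromDec⇔ : ∀ {x} → x ∈ fromDec P? ⇔ P x
  ∈fromDec⇔ = mk⇔ ∈fromDec⁻ ∈fromDec⁺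

x∈p─q⇒x∉q : ∀ {n} {x : Fin n} (p q : Subset n) → x ∈ p ─ q → x ∉ q
x∈p─q⇒x∉q (_ ∷ p) (_    ∷ q) (there x∈p─q) (there x∈q) = x∈p─q⇒x∉q p q x∈p─q x∈q
x∈p─q⇒x∉q (_ ∷ p) (true ∷ q) ()            here

-- The paths in S are removed; their starts count as marked and the remaining vertices are marked freely.
pathSum : ℕ → ℕ → (ℕ → ℤ) → ℤ
pathSum t n χ = ∑[ S ∈ allSubsets (numPaths t n) ]
  when (does (disjoint? t n S)) ((-1ℤ ℤ.^ ∣ S ∣) * binomialSum (n ∸ suc t ℕ.* ∣ S ∣) (λ i → χ (∣ S ∣ ℕ.+ i)))

goodSum : ℕ → ℕ → (ℕ → ℤ) → ℤ
goodSum t n χ = ∑[ M ∈ allSubsets n ] when (does (goodCycle? t M)) (χ ∣ M ∣)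

module Cycle (t : ℕ) {m : ℕ} (t<n : t < suc m) where

  private
    n = suc m

  OnPath : Fin n → Fin n → Set
  OnPath p v = ∃ λ (a : Fin (suc t)) → v ≡ shift p (toℕ a)

  onPath? : ∀ p v → Dec (OnPath p v)
  onPath? p v = any? (λ a → v ≟ᶠ shift p (toℕ a))

  PathsDisjoint : Subset n → Set
  PathsDisjoint S = ∀ p q → p ∈ S → q ∈ S → p ≢ q →
                    ∀ (a b : Fin (suc t)) → shift p (toℕ a) ≢ shift q (toℕ b)

  pathsDisjoint? : ∀ S → Dec (PathsDisjoint S)
  pathsDisjoint? S =
    all? λ p → all? λ q → (p ∈? S) →-dec ((q ∈? S) →-dec (¬? (p ≟ᶠ q) →-dec
      all? λ a → all? λ b → ¬? (shift p (toℕ a) ≟ᶠ shift q (toℕ b))))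

  Covered : Subset n → Fin n → Set
  Covered S v = ∃ λ p → p ∈ S × OnPath p v

  covered? : ∀ S v → Dec (Covered S v)
  covered? S v = any? (λ p → (p ∈? S) ×-dec onPath? p v)

  cover : Subset n → Subset n
  cover S = fromDec (covered? S)

  Violates : Subset n → Fin n → Set
  Violates M v = v ∈ M × FollowedByUnmarked t M v

  violates? : ∀ M v → Dec (Violates M v)
  violates? M v = (v ∈? M) ×-dec ((t <? n) ×-dec all? (λ (j : Fin t) → ¬? (shift v (suc (toℕ j)) ∈? M)))

  violations : Subset n → Subset n
  violations M = fromDec (violates? M)

  offset<n : ∀ (a : Fin (suc t)) → toℕ a < n
  offset<n a = ℕ.≤-trans (toℕ<n a) t<n

  offset-∸≤t : ∀ (a b : Fin (suc t)) → toℕ a ∸ toℕ b ≤ t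
  offset-∸≤t a b = ℕ.≤-trans (ℕ.m∸n≤m (toℕ a) (toℕ b)) (ℕ.≤-pred (toℕ<n a))

  ∈cover : ∀ {S p} (a : Fin (suc t)) → p ∈ S → shift p (toℕ a) ∈ cover S
  ∈cover {S} {p} a p∈S = ∈fromDec⁺ (covered? S) (p , p∈S , a , refl)

  S⊆cover : ∀ S → S ⊆ cover S
  S⊆cover S {p} p∈S = subst (_∈ cover S) (shift-zero p) (∈cover zero p∈S)

  start-unique : ∀ {S} → PathsDisjoint S → ∀ {v p q} → p ∈ S × OnPath p v → q ∈ S × OnPath q v → p ≡ q
  start-unique disjoint {v} {p} {q} (p∈S , a , v≡pa) (q∈S , b , v≡qb) with p ≟ᶠ q
  ... | yes p≡q = p≡q
  ... | no  p≢q = contradiction (trans (sym v≡pa) v≡qb) (disjoint p q p∈S q∈S p≢q a b)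

  offset-unique : ∀ {p v} {a b : Fin (suc t)} → v ≡ shift p (toℕ a) → v ≡ shift p (toℕ b) → a ≡ b
  offset-unique {p} {a = a} {b} v≡pa v≡pb =
    toℕ-injective (shift-injective p (offset<n a) (offset<n b) (trans (sym v≡pa) v≡pb))

  ∑-onPath : ∀ p → ∑[ v ∈ allFin n ] when (does (onPath? p v)) 1ℤ ≡ + suc t
  ∑-onPath p = begin
    ∑[ v ∈ allFin n ] when (does (onPath? p v)) 1ℤ
      ≡⟨ ∑-cong (allFin n) (λ v → ∑-atMostOne (λ a → v ≟ᶠ shift p (toℕ a)) (offset-unique {p})) ⟨
    ∑[ v ∈ allFin n ] ∑[ a ∈ allFin (suc t) ] when (does (v ≟ᶠ shift p (toℕ a))) 1ℤ
      ≡⟨ ∑-comm (allFin n) (allFin (suc t)) (λ v a → when (does (v ≟ᶠ shift p (toℕ a))) 1ℤ) ⟩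
    ∑[ a ∈ allFin (suc t) ] ∑[ v ∈ allFin n ] when (does (v ≟ᶠ shift p (toℕ a))) 1ℤ
      ≡⟨ ∑-cong (allFin (suc t)) (λ a → ∑-δ (shift p (toℕ a))) ⟩
    ∑[ a ∈ allFin (suc t) ] 1ℤ
      ≡⟨ ∑-allFin-1 (suc t) ⟩
    + suc t ∎

  cover-size : ∀ S → PathsDisjoint S → ∣ cover S ∣ ≡ suc t ℕ.* ∣ S ∣
  cover-size S disjoint = ℤ.+-injective (begin
    + ∣ cover S ∣
      ≡⟨ ∣p∣≡∑ (cover S) ⟩
    ∑[ v ∈ allFin n ] when (does (v ∈? cover S)) 1ℤ
      ≡⟨ ∑-cong (allFin n) (λ v → cong (λ b → when b 1ℤ) (does-⇔ (∈fromDec⇔ (covered? S)) (v ∈? cover S) (covered? S v))) ⟩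
    ∑[ v ∈ allFin n ] when (does (covered? S v)) 1ℤ
      ≡⟨ ∑-cong (allFin n) (λ v → ∑-atMostOne (λ p → (p ∈? S) ×-dec onPath? p v) (start-unique disjoint)) ⟨
    ∑[ v ∈ allFin n ] ∑[ p ∈ allFin n ] when (does (p ∈? S) ∧ does (onPath? p v)) 1ℤ
      ≡⟨ ∑-cong (allFin n) (λ v → ∑-cong (allFin n) (λ p → when-∧ (does (p ∈? S)) (does (onPath? p v)) 1ℤ)) ⟩
    ∑[ v ∈ allFin n ] ∑[ p ∈ allFin n ] when (does (p ∈? S)) (when (does (onPath? p v)) 1ℤ)
      ≡⟨ ∑-comm (allFin n) (allFin n) (λ v p → when (does (p ∈? S)) (when (does (onPath? p v)) 1ℤ)) ⟩
    ∑[ p ∈ allFin n ] ∑[ v ∈ allFin n ] when (does (p ∈? S)) (when (does (onPath? p v)) 1ℤ)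
      ≡⟨ ∑-cong (allFin n) (λ p → when-∑ (allFin n) (does (p ∈? S)) (λ v → when (does (onPath? p v)) 1ℤ)) ⟨
    ∑[ p ∈ allFin n ] when (does (p ∈? S)) (∑[ v ∈ allFin n ] when (does (onPath? p v)) 1ℤ)
      ≡⟨ ∑-cong (allFin n) (λ p → cong (when (does (p ∈? S))) (∑-onPath p)) ⟩
    ∑[ p ∈ allFin n ] when (does (p ∈? S)) (+ suc t)
      ≡⟨ ∑-cong (allFin n) (λ p → trans (cong (when (does (p ∈? S))) (sym (ℤ.*-identityʳ (+ suc t))))
                                         (when-*ˡ (does (p ∈? S)) (+ suc t) 1ℤ)) ⟩
    ∑[ p ∈ allFin n ] (+ suc t * when (does (p ∈? S)) 1ℤ)
      ≡⟨ *-distribˡ-∑ (allFin n) (+ suc t) (λ p → when (does (p ∈? S)) 1ℤ) ⟨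
    + suc t * ∑[ p ∈ allFin n ] when (does (p ∈? S)) 1ℤ
      ≡⟨ cong (_*_ (+ suc t)) (∣p∣≡∑ S) ⟨
    + suc t * + ∣ S ∣
      ≡⟨ ℤ.pos-* (suc t) ∣ S ∣ ⟨
    + (suc t ℕ.* ∣ S ∣) ∎)

  pathsDisjoint⇒bound : ∀ S → PathsDisjoint S → suc t ℕ.* ∣ S ∣ ≤ n
  pathsDisjoint⇒bound S disjoint = subst (_≤ n) (cover-size S disjoint) (∣p∣≤n (cover S))

  violations⊆ : ∀ M → violations M ⊆ M
  violations⊆ M = proj₁ ∘ ∈fromDec⁻ (violates? M)

  violation⇒unmarked : ∀ {M v} → v ∈ violations M → ∀ (j : Fin t) → shift v (suc (toℕ j)) ∉ M
  violation⇒unmarked {M} v∈V = proj₂ (proj₂ (∈fromDec⁻ (violates? M) v∈V))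

  ⊆violations : ∀ {S M} → S ⊆ M → M ─ S ⊆ ∁ (cover S) → PathsDisjoint S → S ⊆ violations M
  ⊆violations {S} {M} S⊆M avoids disjoint {v} v∈S =
    ∈fromDec⁺ (violates? M) (S⊆M v∈S , t<n , λ j → unmarked j)
    where
    unmarked : ∀ (j : Fin t) → shift v (suc (toℕ j)) ∉ M
    unmarked j w∈M with shift v (suc (toℕ j)) ∈? S
    ... | yes w∈S = disjoint v w v∈S w∈S v≢w (suc j) zero (sym (shift-zero w))
      where
      w = shift v (suc (toℕ j))
      v≢w : v ≢ w
      v≢w v≡w = contradiction (shift≡⇒0 v (ℕ.≤-<-trans (toℕ<n j) t<n) (sym v≡w)) λ ()
    ... | no  w∉S = x∈∁p⇒x∉p (avoids (x∈p∧x∉q⇒x∈p─q w∈M w∉S)) (∈cover (suc j) v∈S)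

  ⊆violations⇒avoids : ∀ {S M} → S ⊆ violations M → M ─ S ⊆ ∁ (cover S)
  ⊆violations⇒avoids {S} {M} S⊆V {w} w∈M─S =
    x∉p⇒x∈∁p (λ w∈cover → uncovered (∈fromDec⁻ (covered? S) w∈cover))
    where
    uncovered : ¬ Covered S w
    uncovered (p , p∈S , zero  , w≡p) =
      x∈p─q⇒x∉q M S w∈M─S (subst (_∈ S) (sym (trans w≡p (shift-zero p))) p∈S)
    uncovered (p , p∈S , suc j , w≡p+j+1) =
      violation⇒unmarked (S⊆V p∈S) j (subst (_∈ M) w≡p+j+1 (p─q⊆p M S w∈M─S))

  ⊆violations⇒noShortGap : ∀ {S M} → S ⊆ violations M →
    ∀ {p q d} → p ∈ S → q ∈ S → p ≢ q → d ≤ t → shift p d ≢ q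
  ⊆violations⇒noShortGap S⊆V {p} {d = zero}  p∈S q∈S p≢q _     pd≡q = p≢q (trans (sym (shift-zero p)) pd≡q)
  ⊆violations⇒noShortGap {M = M} S⊆V {p} {q} {suc d} p∈S q∈S p≢q d<t pd≡q =
    violation⇒unmarked (S⊆V p∈S) (fromℕ< d<t) (subst (_∈ M) q≡ (violations⊆ M (S⊆V q∈S)))
    where
    q≡ : q ≡ shift p (suc (toℕ (fromℕ< d<t)))
    q≡ = trans (sym pd≡q) (cong (λ k → shift p (suc k)) (sym (toℕ-fromℕ< d<t)))

  ⊆violations⇒disjoint : ∀ {S M} → S ⊆ violations M → PathsDisjoint S
  ⊆violations⇒disjoint {S} {M} S⊆V p q p∈S q∈S p≢q a b pa≡qb with ℕ.≤-total (toℕ b) (toℕ a)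
  ... | inj₁ b≤a = ⊆violations⇒noShortGap {S} {M} S⊆V p∈S q∈S p≢q (offset-∸≤t a b) (shift-∸ p q b≤a pa≡qb)
  ... | inj₂ a≤b =
    ⊆violations⇒noShortGap {S} {M} S⊆V q∈S p∈S (p≢q ∘ sym) (offset-∸≤t b a) (shift-∸ q p a≤b (sym pa≡qb))

  ⊆violations⇔ : ∀ S M → (S ⊆ M × M ─ S ⊆ ∁ (cover S) × PathsDisjoint S) ⇔ S ⊆ violations M
  ⊆violations⇔ S M = mk⇔ (λ (S⊆M , avoids , disjoint) → ⊆violations S⊆M avoids disjoint) from
    where
    from : S ⊆ violations M → S ⊆ M × M ─ S ⊆ ∁ (cover S) × PathsDisjoint S
    from S⊆V = (λ v∈S → violations⊆ M (S⊆V v∈S))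
             , ⊆violations⇒avoids {S} {M} S⊆V
             , ⊆violations⇒disjoint {S} {M} S⊆V

  violations⊆⊥⇔good : ∀ M → violations M ⊆ ⊥ ⇔ GoodCycle t M
  violations⊆⊥⇔good M = mk⇔ to from
    where
    to : violations M ⊆ ⊥ → GoodCycle t M
    to V⊆⊥ v v∈M followed = ∉⊥ (V⊆⊥ (∈fromDec⁺ (violates? M) (v∈M , followed)))
    from : GoodCycle t M → violations M ⊆ ⊥
    from good {v} v∈V = let v∈M , followed = ∈fromDec⁻ (violates? M) v∈V in ⊥-elim (good v v∈M followed)

  binomialSum≡∑⊆∁cover : ∀ S → PathsDisjoint S → ∀ ψ →
    binomialSum (n ∸ suc t ℕ.* ∣ S ∣) ψ ≡ ∑[ M ∈ allSubsets n ] when (does (M ⊆? ∁ (cover S))) (ψ ∣ M ∣)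
  binomialSum≡∑⊆∁cover S disjoint ψ = begin
    binomialSum (n ∸ suc t ℕ.* ∣ S ∣) ψ  ≡⟨ cong (λ k → binomialSum (n ∸ k) ψ) (cover-size S disjoint) ⟨
    binomialSum (n ∸ ∣ cover S ∣) ψ      ≡⟨ cong (λ k → binomialSum k ψ) (∣∁p∣≡n∸∣p∣ (cover S)) ⟨
    binomialSum ∣ ∁ (cover S) ∣ ψ        ≡⟨ ∑-⊆-size (∁ (cover S)) ψ ⟨
    ∑[ M ∈ allSubsets n ] when (does (M ⊆? ∁ (cover S))) (ψ ∣ M ∣) ∎

  -- M ∪ S is the marking; S ⊆ cover S makes the two side conditions compatible.
  avoiding-reindex : ∀ S M b s (χ : ℕ → ℤ) →
    when b (s * when (does (M ⊆? ∁ (cover S))) (χ (∣ S ∣ ℕ.+ ∣ M ∣)))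
    ≡ when (does (M ⊆? ∁ S)) (when (does ((M ∪ S) ─ S ⊆? ∁ (cover S))) (when b (s * χ ∣ M ∪ S ∣)))
  avoiding-reindex S M b s χ with M ⊆? ∁ S
  ... | yes M⊆∁S rewrite [p∪q]─q≡p M S M⊆∁S | ∣p∪q∣≡∣q∣+∣p∣ M S M⊆∁S =
    trans (cong (when b) (sym (when-*ˡ c s (χ (∣ S ∣ ℕ.+ ∣ M ∣))))) (when-comm b c _)
    where c = does (M ⊆? ∁ (cover S))
  ... | no  M⊈∁S
    rewrite dec-false (M ⊆? ∁ (cover S)) (λ M⊆∁C → M⊈∁S (⊆-trans M⊆∁C (p⊆q⇒∁p⊇∁q (S⊆cover S)))) =
    trans (cong (when b) (ℤ.*-zeroʳ s)) (when-zero b)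

  violations-weight : ∀ S M s y →
    when (does (S ⊆? M)) (when (does (M ─ S ⊆? ∁ (cover S))) (when (does (pathsDisjoint? S)) (s * y)))
    ≡ when (does (S ⊆? violations M)) s * y
  violations-weight S M s y = begin
    when (does (S ⊆? M)) (when (does (M ─ S ⊆? ∁ (cover S))) (when (does (pathsDisjoint? S)) (s * y)))
      ≡⟨ cong (when (does (S ⊆? M))) (when-∧ (does (M ─ S ⊆? ∁ (cover S))) _ _) ⟨
    when (does (S ⊆? M)) (when (does (M ─ S ⊆? ∁ (cover S)) ∧ does (pathsDisjoint? S)) (s * y))
      ≡⟨ when-∧ (does (S ⊆? M)) _ _ ⟨
    when (does conditions?) (s * y)
      ≡⟨ cong (λ b → when b (s * y)) (does-⇔ (⊆violations⇔ S M) conditions? (S ⊆? violations M)) ⟩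
    when (does (S ⊆? violations M)) (s * y)
      ≡⟨ when-*ʳ (does (S ⊆? violations M)) s y ⟩
    when (does (S ⊆? violations M)) s * y ∎
    where conditions? = (S ⊆? M) ×-dec ((M ─ S ⊆? ∁ (cover S)) ×-dec pathsDisjoint? S)

  cycleIdentity< : ∀ (χ : ℕ → ℤ) →
    ∑[ S ∈ allSubsets n ]
      when (does (pathsDisjoint? S)) ((-1ℤ ℤ.^ ∣ S ∣) * binomialSum (n ∸ suc t ℕ.* ∣ S ∣) (λ i → χ (∣ S ∣ ℕ.+ i)))
    ≡ goodSum t n χ
  cycleIdentity< χ = begin
    ∑[ S ∈ 𝒫 ] when (d S) (sign S * binomialSum (n ∸ suc t ℕ.* ∣ S ∣) (λ i → χ (∣ S ∣ ℕ.+ i)))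
      ≡⟨ ∑-cong 𝒫 (λ S → when-cong-dec (pathsDisjoint? S) λ disjoint →
           cong (sign S *_) (binomialSum≡∑⊆∁cover S disjoint (λ i → χ (∣ S ∣ ℕ.+ i)))) ⟩
    ∑[ S ∈ 𝒫 ] when (d S) (sign S * ∑[ M ∈ 𝒫 ] when (does (M ⊆? ∁ (cover S))) (χ (∣ S ∣ ℕ.+ ∣ M ∣)))
      ≡⟨ ∑-cong 𝒫 (λ S → trans (cong (when (d S)) (*-distribˡ-∑ 𝒫 (sign S) _)) (when-∑ 𝒫 (d S) _)) ⟩
    ∑[ S ∈ 𝒫 ] ∑[ M ∈ 𝒫 ] when (d S) (sign S * when (does (M ⊆? ∁ (cover S))) (χ (∣ S ∣ ℕ.+ ∣ M ∣)))
      ≡⟨ ∑-cong 𝒫 (λ S → ∑-cong 𝒫 (λ M → avoiding-reindex S M (d S) (sign S) χ)) ⟩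
    ∑[ S ∈ 𝒫 ] ∑[ M ∈ 𝒫 ] when (does (M ⊆? ∁ S)) (F S (M ∪ S))
      ≡⟨ ∑-cong 𝒫 (λ S → ∑-reindex-∪ S (F S)) ⟩
    ∑[ S ∈ 𝒫 ] ∑[ M ∈ 𝒫 ] when (does (S ⊆? M)) (F S M)
      ≡⟨ ∑-comm 𝒫 𝒫 (λ S M → when (does (S ⊆? M)) (F S M)) ⟩
    ∑[ M ∈ 𝒫 ] ∑[ S ∈ 𝒫 ] when (does (S ⊆? M)) (F S M)
      ≡⟨ ∑-cong 𝒫 (λ M → ∑-cong 𝒫 (λ S → violations-weight S M (sign S) (χ ∣ M ∣))) ⟩
    ∑[ M ∈ 𝒫 ] ∑[ S ∈ 𝒫 ] (when (does (S ⊆? violations M)) (sign S) * χ ∣ M ∣)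
      ≡⟨ ∑-cong 𝒫 (λ M → *-distribʳ-∑ 𝒫 (χ ∣ M ∣) (λ S → when (does (S ⊆? violations M)) (sign S))) ⟨
    ∑[ M ∈ 𝒫 ] (∑[ S ∈ 𝒫 ] when (does (S ⊆? violations M)) (sign S) * χ ∣ M ∣)
      ≡⟨ ∑-cong 𝒫 (λ M → cong (_* χ ∣ M ∣) (∑-⊆-alternating (violations M))) ⟩
    ∑[ M ∈ 𝒫 ] (when (does (violations M ⊆? ⊥)) 1ℤ * χ ∣ M ∣)
      ≡⟨ ∑-cong 𝒫 (λ M → trans (when-1* _ (χ ∣ M ∣))
           (cong (λ b → when b (χ ∣ M ∣)) (does-⇔ (violations⊆⊥⇔good M) (violations M ⊆? ⊥) (goodCycle? t M)))) ⟩
    ∑[ M ∈ 𝒫 ] when (does (goodCycle? t M)) (χ ∣ M ∣) ∎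
    where
    𝒫 = allSubsets n
    d = λ S → does (pathsDisjoint? S)
    sign = λ (S : Subset n) → -1ℤ ℤ.^ ∣ S ∣
    F : Subset n → Subset n → ℤ
    F S M = when (does (M ─ S ⊆? ∁ (cover S))) (when (d S) (sign S * χ ∣ M ∣))

pathSum-< : ∀ t m (χ : ℕ → ℤ) (t<n : t < suc m) →
  pathSum t (suc m) χ ≡ ∑[ S ∈ allSubsets (suc m) ]
    when (does (Cycle.pathsDisjoint? t t<n S)) ((-1ℤ ℤ.^ ∣ S ∣) * binomialSum (suc m ∸ suc t ℕ.* ∣ S ∣) (λ i → χ (∣ S ∣ ℕ.+ i)))
pathSum-< t m χ t<n with t <? suc m
... | yes _   = refl -- once t < n is decided, disjoint? unfolds to Cycle.pathsDisjoint?
... | no  t≮n = contradiction t<n t≮n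

pathSum-≮ : ∀ t n (χ : ℕ → ℤ) → ¬ t < n → pathSum t n χ ≡ binomialSum n χ
pathSum-≮ t n χ t≮n with t <? n
... | yes t<n = contradiction t<n t≮n
... | no  _   = trans (ℤ.+-identityʳ _) (trans (ℤ.*-identityˡ _) (cong (λ k → binomialSum (n ∸ k) χ) (ℕ.*-zeroʳ (suc t))))

goodSum-≮ : ∀ t n (χ : ℕ → ℤ) → ¬ t < n → goodSum t n χ ≡ binomialSum n χ
goodSum-≮ t n χ t≮n = trans
  (∑-cong (allSubsets n) λ M → cong (λ b → when b (χ ∣ M ∣)) (dec-true (goodCycle? t M) λ v _ (t<n , _) → t≮n t<n))
  (∑-allSubsets-size n χ)

cycleIdentity : ∀ t n (χ : ℕ → ℤ) → pathSum t n χ ≡ goodSum t n χ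
cycleIdentity t zero    χ = trans (pathSum-≮ t 0 χ λ ()) (sym (goodSum-≮ t 0 χ λ ()))
-- Splitting by a with on t <? n would also abstract the test hidden inside goodCycle?.
cycleIdentity t (suc m) χ = byCases (t <? suc m)
  where
  byCases : Dec (t < suc m) → pathSum t (suc m) χ ≡ goodSum t (suc m) χ
  byCases (yes t<n) = trans (pathSum-< t m χ t<n) (Cycle.cycleIdentity< t t<n χ)
  byCases (no  t≮n) = trans (pathSum-≮ t (suc m) χ t≮n) (sym (goodSum-≮ t (suc m) χ t≮n))

disjoint⇒bound : ∀ t n S → Disjoint t n S → suc t ℕ.* ∣ S ∣ ≤ n
disjoint⇒bound t n S disjoint with t <? n
disjoint⇒bound t (suc m) S disjoint | yes t<n = Cycle.pathsDisjoint⇒bound t t<n S disjoint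
disjoint⇒bound t zero    S _        | yes ()
disjoint⇒bound t n       [] _       | no  _   = ℕ.≤-trans (ℕ.≤-reflexive (ℕ.*-zeroʳ (suc t))) ℕ.z≤n

markingSum : ℕ → (ns : List ℕ) → (ℕ → ℤ) → ℤ
markingSum t ns ψ = ∑[ m ∈ allMarkings ns ] when (does (goodMarking? t m)) (ψ (numMarked m))

module _ (t : ℕ) where

  markingSum-[] : ∀ ψ → markingSum t [] ψ ≡ ψ 0
  markingSum-[] ψ = ℤ.+-identityʳ (ψ 0)

  markingSum-∷ : ∀ n ns ψ → markingSum t (n ∷ ns) ψ ≡ goodSum t n (λ c → markingSum t ns (λ k → ψ (c ℕ.+ k)))
  markingSum-∷ n ns ψ =
    trans (∑-concatMap (λ M → map (M ∷_) (allMarkings ns)) (allSubsets n) _)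
          (∑-cong (allSubsets n) λ M →
            trans (∑-map (M ∷_) (allMarkings ns) _)
            (trans (∑-cong (allMarkings ns) (λ m → when-∧ (does (goodCycle? t M)) (does (goodMarking? t m)) _))
                   (sym (when-∑ (allMarkings ns) (does (goodCycle? t M)) _))))

  markingSum-cong : ∀ ns {ψ ψ′ : ℕ → ℤ} → (∀ k → ψ k ≡ ψ′ k) → markingSum t ns ψ ≡ markingSum t ns ψ′
  markingSum-cong ns ψ≗ψ′ = ∑-cong (allMarkings ns) (λ m → cong (when _) (ψ≗ψ′ (numMarked m)))

  markingSum-∑ : ∀ ns {X : Set} (xs : List X) (F : X → ℕ → ℤ) →
                 markingSum t ns (λ k → ∑[ x ∈ xs ] F x k) ≡ ∑[ x ∈ xs ] markingSum t ns (F x)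
  markingSum-∑ ns xs F =
    trans (∑-cong (allMarkings ns) (λ m → when-∑ xs (does (goodMarking? t m)) _))
          (∑-comm (allMarkings ns) xs _)

  markingSum-* : ∀ ns a ψ → markingSum t ns (λ k → a * ψ k) ≡ a * markingSum t ns ψ
  markingSum-* ns a ψ =
    trans (∑-cong (allMarkings ns) (λ m → when-*ˡ (does (goodMarking? t m)) a _))
          (sym (*-distribˡ-∑ (allMarkings ns) a _))

  markingSum-when : ∀ ns b ψ → markingSum t ns (λ k → when b (ψ k)) ≡ when b (markingSum t ns ψ)
  markingSum-when ns b ψ =
    trans (∑-cong (allMarkings ns) (λ m → when-comm (does (goodMarking? t m)) b _))
          (sym (when-∑ (allMarkings ns) b _))

  countMarkings≡markingSum : ∀ ns →
    + countMarkings t ns ≡ markingSum t ns (λ k → when (does (suc t ℕ.* k ≟ totalVertices ns)) 1ℤ)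
  countMarkings≡markingSum ns = begin
    + length (filter (valid? t ns) (allMarkings ns))        ≡⟨ ∑-const-1 (filter (valid? t ns) (allMarkings ns)) ⟨
    ∑ (filter (valid? t ns) (allMarkings ns)) (λ _ → 1ℤ)    ≡⟨ ∑-filter (valid? t ns) (allMarkings ns) _ ⟩
    ∑[ m ∈ allMarkings ns ] when (does (valid? t ns m)) 1ℤ  ≡⟨ ∑-cong (allMarkings ns) (λ m →
                                                                 trans (when-∧ (does (suc t ℕ.* numMarked m ≟ totalVertices ns)) _ 1ℤ)
                                                                       (when-comm _ (does (goodMarking? t m)) 1ℤ)) ⟩
    markingSum t ns (λ k → when (does (suc t ℕ.* k ≟ totalVertices ns)) 1ℤ) ∎

[m∸n]+[o∸p]≡[m+o]∸[n+p] : ∀ {m n o p} → n ≤ m → p ≤ o → (m ∸ n) ℕ.+ (o ∸ p) ≡ (m ℕ.+ o) ∸ (n ℕ.+ p)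
[m∸n]+[o∸p]≡[m+o]∸[n+p] {m} {n} {o} {p} n≤m p≤o = begin
  (m ∸ n) ℕ.+ (o ∸ p)   ≡⟨ ℕ.+-∸-assoc (m ∸ n) p≤o ⟨
  (m ∸ n) ℕ.+ o ∸ p     ≡⟨ cong (_∸ p) (ℕ.+-∸-comm o n≤m) ⟨
  (m ℕ.+ o) ∸ n ∸ p     ≡⟨ ℕ.∸-+-assoc (m ℕ.+ o) n p ⟩
  (m ℕ.+ o) ∸ (n ℕ.+ p) ∎

-- s is the number of t-paths taken so far; each of them contributes one marked vertex.
BinomialMoments : ℕ → ℕ → (ℕ → ℤ) → (ℕ → ℤ) → Set
BinomialMoments t N ψ φ = ∀ s → suc t ℕ.* s ≤ N →
  φ (N ∸ suc t ℕ.* s) ≡ binomialSum (N ∸ suc t ℕ.* s) (λ j → ψ (s ℕ.+ j))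

BinomialMoments-split : ∀ t n N c {ψ φ} → suc t ℕ.* c ≤ n → BinomialMoments t (n ℕ.+ N) ψ φ →
  BinomialMoments t N (λ k → binomialSum (n ∸ suc t ℕ.* c) (λ i → ψ ((c ℕ.+ i) ℕ.+ k)))
                      (λ j → φ ((n ∸ suc t ℕ.* c) ℕ.+ j))
BinomialMoments-split t n N c {ψ} {φ} [t+1]c≤n moments s [t+1]s≤N = begin
  φ (a ℕ.+ m)                                        ≡⟨ cong φ a+m≡ ⟩
  φ ((n ℕ.+ N) ∸ suc t ℕ.* (c ℕ.+ s))                ≡⟨ moments (c ℕ.+ s) [t+1][c+s]≤n+N ⟩
  binomialSum ((n ℕ.+ N) ∸ suc t ℕ.* (c ℕ.+ s)) χ    ≡⟨ cong (λ k → binomialSum k χ) (trans (sym a+m≡) (ℕ.+-comm a m)) ⟩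
  binomialSum (m ℕ.+ a) χ                            ≡⟨ binomialSum-+ m a χ ⟩
  binomialSum m (λ j → binomialSum a (λ i → ψ ((c ℕ.+ s) ℕ.+ (j ℕ.+ i))))
    ≡⟨ binomialSum-cong m (λ j → binomialSum-cong a (λ i → cong ψ (rearrange c s j i))) ⟩
  binomialSum m (λ j → binomialSum a (λ i → ψ ((c ℕ.+ i) ℕ.+ (s ℕ.+ j)))) ∎
  where
  a = n ∸ suc t ℕ.* c
  m = N ∸ suc t ℕ.* s
  χ = λ j → ψ ((c ℕ.+ s) ℕ.+ j)
  [t+1][c+s]≡ : suc t ℕ.* (c ℕ.+ s) ≡ suc t ℕ.* c ℕ.+ suc t ℕ.* s
  [t+1][c+s]≡ = ℕ.*-distribˡ-+ (suc t) c s
  a+m≡ : a ℕ.+ m ≡ (n ℕ.+ N) ∸ suc t ℕ.* (c ℕ.+ s)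
  a+m≡ = trans ([m∸n]+[o∸p]≡[m+o]∸[n+p] [t+1]c≤n [t+1]s≤N) (cong ((n ℕ.+ N) ∸_) (sym [t+1][c+s]≡))
  [t+1][c+s]≤n+N : suc t ℕ.* (c ℕ.+ s) ≤ n ℕ.+ N
  [t+1][c+s]≤n+N = subst (_≤ n ℕ.+ N) (sym [t+1][c+s]≡) (ℕ.+-mono-≤ [t+1]c≤n [t+1]s≤N)
  rearrange : ∀ c s j i → (c ℕ.+ s) ℕ.+ (j ℕ.+ i) ≡ (c ℕ.+ i) ℕ.+ (s ℕ.+ j)
  rearrange = ℕ-Solver.solve-∀

module _ (t : ℕ) where

  Λ-prodTcheb : ∀ ns φ ψ → BinomialMoments t (totalVertices ns) ψ φ →
                Λ φ (prodPoly (map (Tcheb t) ns)) ≡ markingSum t ns ψ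
  Λ-prodTcheb [] φ ψ moments = begin
    1ℤ * φ 0 + 0ℤ                        ≡⟨ trans (ℤ.+-identityʳ _) (ℤ.*-identityˡ _) ⟩
    φ 0                                  ≡⟨ cong φ (ℕ.0∸n≡0 (suc t ℕ.* 0)) ⟨
    φ (0 ∸ suc t ℕ.* 0)                  ≡⟨ moments 0 (ℕ.≤-reflexive (ℕ.*-zeroʳ (suc t))) ⟩
    binomialSum (0 ∸ suc t ℕ.* 0) ψ      ≡⟨ cong (λ k → binomialSum k ψ) (ℕ.0∸n≡0 (suc t ℕ.* 0)) ⟩
    ψ 0                                  ≡⟨ markingSum-[] t ψ ⟨
    markingSum t [] ψ                    ∎
  Λ-prodTcheb (n ∷ ns) φ ψ moments = begin
    Λ φ (Tcheb t n *ₚ P)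
      ≡⟨ Λ-*ₚ φ (Tcheb t n) P ⟩
    Λ (λ i → Λ (λ j → φ (i ℕ.+ j)) P) (Tcheb t n)
      ≡⟨ Λ-Tcheb _ t n ⟩
    ∑[ S ∈ paths ] when (d S) (sign S * Λ (λ j → φ (rest S ℕ.+ j)) P)
      ≡⟨ ∑-cong paths (λ S → when-cong-dec (disjoint? t n S) λ dS → cong (sign S *_)
           (Λ-prodTcheb ns (λ j → φ (rest S ℕ.+ j)) (ψ′ ∣ S ∣)
              (BinomialMoments-split t n (totalVertices ns) ∣ S ∣ {ψ} {φ} (disjoint⇒bound t n S dS) moments))) ⟩
    ∑[ S ∈ paths ] when (d S) (sign S * markingSum t ns (ψ′ ∣ S ∣))
      ≡⟨ ∑-cong paths (λ S → trans (markingSum-when t ns (d S) (λ k → sign S * ψ′ ∣ S ∣ k))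
                                   (cong (when (d S)) (markingSum-* t ns (sign S) (ψ′ ∣ S ∣)))) ⟨
    ∑[ S ∈ paths ] markingSum t ns (λ k → when (d S) (sign S * ψ′ ∣ S ∣ k))
      ≡⟨ markingSum-∑ t ns paths (λ S k → when (d S) (sign S * ψ′ ∣ S ∣ k)) ⟨
    markingSum t ns (λ k → pathSum t n (λ i → ψ (i ℕ.+ k)))
      ≡⟨ markingSum-cong t ns (λ k → cycleIdentity t n (λ i → ψ (i ℕ.+ k))) ⟩
    markingSum t ns (λ k → goodSum t n (λ c → ψ (c ℕ.+ k)))
      ≡⟨ markingSum-∑ t ns (allSubsets n) (λ M k → when (does (goodCycle? t M)) (ψ (∣ M ∣ ℕ.+ k))) ⟩
    ∑[ M ∈ allSubsets n ] markingSum t ns (λ k → when (does (goodCycle? t M)) (ψ (∣ M ∣ ℕ.+ k)))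
      ≡⟨ ∑-cong (allSubsets n) (λ M → markingSum-when t ns (does (goodCycle? t M)) (λ k → ψ (∣ M ∣ ℕ.+ k))) ⟩
    goodSum t n (λ c → markingSum t ns (λ k → ψ (c ℕ.+ k)))
      ≡⟨ markingSum-∷ t n ns ψ ⟨
    markingSum t (n ∷ ns) ψ ∎
    where
    P = prodPoly (map (Tcheb t) ns)
    paths = allSubsets (numPaths t n)
    d = λ S → does (disjoint? t n S)
    sign = λ (S : Subset (numPaths t n)) → -1ℤ ℤ.^ ∣ S ∣
    rest = λ (S : Subset (numPaths t n)) → n ∸ suc t ℕ.* ∣ S ∣
    ψ′ : ℕ → ℕ → ℤ
    ψ′ c k = binomialSum (n ∸ suc t ℕ.* c) (λ i → ψ ((c ℕ.+ i) ℕ.+ k))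

  Lmon-binomialMoments : ∀ N → BinomialMoments t N (λ k → when (does (suc t ℕ.* k ≟ N)) 1ℤ) (Lmon t)
  Lmon-binomialMoments N s [t+1]s≤N =
    trans (Lmon≡binomialSum t m) (binomialSum-cong m λ j →
      cong (λ b → when b 1ℤ) (does-⇔ (mk⇔ to from) (suc t ℕ.* j ≟ m) (suc t ℕ.* (s ℕ.+ j) ≟ N)))
    where
    m = N ∸ suc t ℕ.* s
    m+[t+1]s≡N : m ℕ.+ suc t ℕ.* s ≡ N
    m+[t+1]s≡N = ℕ.m∸n+n≡m [t+1]s≤N
    split : ∀ j → suc t ℕ.* (s ℕ.+ j) ≡ suc t ℕ.* j ℕ.+ suc t ℕ.* s
    split j = trans (ℕ.*-distribˡ-+ (suc t) s j) (ℕ.+-comm (suc t ℕ.* s) (suc t ℕ.* j))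
    to : ∀ {j} → suc t ℕ.* j ≡ m → suc t ℕ.* (s ℕ.+ j) ≡ N
    to {j} e = trans (split j) (trans (cong (ℕ._+ suc t ℕ.* s) e) m+[t+1]s≡N)
    from : ∀ {j} → suc t ℕ.* (s ℕ.+ j) ≡ N → suc t ℕ.* j ≡ m
    from {j} e = ℕ.+-cancelʳ-≡ (suc t ℕ.* s) _ _ (trans (sym (split j)) (trans e (sym m+[t+1]s≡N)))

  L-prodTcheb : ∀ ns → L t (prodPoly (map (Tcheb t) ns)) ≡ + countMarkings t ns
  L-prodTcheb ns = begin
    L t (prodPoly (map (Tcheb t) ns))   ≡⟨ L≡Λ t (prodPoly (map (Tcheb t) ns)) ⟩
    Λ (Lmon t) (prodPoly (map (Tcheb t) ns))
      ≡⟨ Λ-prodTcheb ns (Lmon t) ψ₀ (Lmon-binomialMoments (totalVertices ns)) ⟩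
    markingSum t ns ψ₀
      ≡⟨ countMarkings≡markingSum t ns ⟨
    + countMarkings t ns                ∎
    where ψ₀ = λ k → when (does (suc t ℕ.* k ≟ totalVertices ns)) 1ℤ

theorem4p1 : (t : ℕ) → 1 ≤ t → (ns : List ℕ) → ns ≢ [] → All (λ n → 1 ≤ n) ns →
    L t (prodPoly (map (Tcheb t) ns)) ≡ + countMarkings t ns
theorem4p1 t _ ns _ _ = L-prodTcheb t ns
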